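{- Let $(\lambda/\mu,r)$ be an r-shape with edgewise connected diagram, $\mathbf a,\mathbf b$ column flags for it, and $\Theta=(\theta_1,\dots,\theta_k)$ an outer ribbon decomposition. For all $i,j$ such that $\theta_i\#\theta_j$ is a nonempty ribbon, the induced ribbon flags $\mathbf a^{ij},\mathbf b^{ij}$ are column flags for the r-shape $\theta_i\#\theta_j$.
   Context: Skew diagram $\lambda/\mu=\{(i,j):\mu_i<j\le\lambda_i\}$ (English notation), conjugates $\lambda',\mu'$; r-shape content $c(i,j)=j-i+r-1+\lambda'_1$; $\mathrm{row}(i,j)=i$, $\mathrm{col}(i,j)=j$. For an r-shape $\kappa/\nu$ with $n\ge\kappa_1$, column flags are $\mathbf a,\mathbf b\in\mathbb Z^n$ with $a_i-a_{i+1}\le\nu'_i-\nu'_{i+1}+1$, $b_i-b_{i+1}\le\kappa'_i-\kappa'_{i+1}+1$ whenever $\nu'_i<\kappa'_{i+1}$. A ribbon is an edgewise connected skew diagram with no $2\times2$ block; its head is its bottom-left cell, its tail its top-right cell. A cell of $\lambda/\mu$ is on the left/bottom/top/right perimeter if the adjacent position to its left/below/above/right is not a cell of $\lambda/\mu$. An outer ribbon decomposition is a partition of the cells of $\lambda/\mu$ into ribbons $\theta_1,\dots,\theta_k$ whose heads lie on the left or bottom perimeter and whose tails lie on the top or right perimeter. A cell $\gamma\in\theta_i$ goes up if the cell directly above is in $\theta_i$ or $\gamma$ is the tail of $\theta_i$ on the top perimeter; it goes right if the cell directly to its right is in $\theta_i$ or $\gamma$ is the tail of $\theta_i$ on the right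 perimeter; exceptionally, the top-right cell of $\lambda/\mu$ goes up if the cell below it is in its ribbon and goes right if the cell to its left is in its ribbon. All cells of a given content go the same direction. The cutting strip $\Theta(\lambda/\mu)$ is the ribbon with exactly one cell of each content occurring in $\lambda/\mu$, where the cell of content $c+1$ lies directly above (resp. right of) the cell of content $c$ if the cells of $\lambda/\mu$ of content $c$ go up (resp. right). For contents $p\le q$, $\Theta(p,q)$ is the sub-ribbon of cells with contents in $[p,q]$, an r-shape with inherited contents; $\Theta(q+1,q)=\varnothing$; $\Theta(p,q)$ is undefined if $p>q+1$. With $\delta_i,\gamma_i$ the head and tail of $\theta_i$, $\theta_i\#\theta_j=\Theta(c(\delta_i),c(\gamma_j))$. Induced ribbon flags: if $\theta_i\#\theta_j$ is a nonempty ribbon, let $\rho_1,\dots,\rho_K$ be its columns from left to right, $\delta_s,\gamma_s$ the bottom and top cells of $\rho_s$; let $M_s$ be the rightmost cell of $\lambda/\mu$ of content $c(\delta_s)$ and $m_s$ the leftmost cell of $\lambda/\mu$ of content $c(\gamma_s)$. Then $\mathbf a^{ij}=(a^{ij}_s)_{s=1}^K$, $\mathbf b^{ij}=(b^{ij}_s)_{s=1}^K$ with $a^{ij}_s=a_{\mathrm{col}(m_s)}-(\mu'_{\mathrm{col}(m_s)}+1)+\mathrm{row}(m_s)$, $b^{ij}_s=b_{\mathrm{col}(M_s)}-\lambda'_{\mathrm{col}(M_s)}+\mathrm{row}(M_s)$. The ribbon r-shape $\theta_i\#\theta_j$ is regarded (after translation) as a skew diagram occupying columns $1,\dots,K$ with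 its inherited contents. -}

module Defs where

open import Data.Nat as ℕ using (ℕ; zero; suc; _∸_; _≤?_)
open import Data.Integer as ℤ using (ℤ; +_; _-_)
open import Data.Fin using (Fin)
open import Data.List using (List; []; _∷_; length; filter; map; upTo)
open import Data.List.Relation.Unary.Linked using (Linked)
open import Data.Vec using (Vec; []; _∷_)
open import Data.Product using (Σ; _×_; _,_; ∃; proj₁; proj₂)
open import Data.Sum using (_⊎_)
open import Relation.Nullary using (¬_)
open import Relation.Binary.PropositionalEquality using (_≡_)
open import Relation.Binary.Construct.Closure.ReflexiveTransitive using (Star)

-- Partitions, skew diagrams (English notation, 1-indexed rows/columns)

-- A partition is a weakly decreasing list of naturals (trailing zeros allowed).
IsPartition : List ℕ → Set
IsPartition p = Linked ℕ._≥_ p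

-- p_i (1-indexed), 0 beyond the length of the list
partAt : List ℕ → ℕ → ℕ
partAt []       _             = 0
partAt (x ∷ xs) zero          = 0
partAt (x ∷ xs) (suc zero)    = x
partAt (x ∷ xs) (suc (suc i)) = partAt xs (suc i)

conjAt : List ℕ → ℕ → ℕ
conjAt p j = length (filter (j ≤?_) p)

conjList : List ℕ → List ℕ
conjList p = map (λ j → conjAt p (suc j)) (upTo (partAt p 1))

_⊆ₚ_ : List ℕ → List ℕ → Set
μ ⊆ₚ λp = ∀ i → partAt μ i ℕ.≤ partAt λp i

-- cells are (row , column)
Cell : Set
Cell = ℕ × ℕ

row col : Cell → ℕ
row = proj₁
col = proj₂

InSkew : List ℕ → List ℕ → Cell → Set
InSkew λp μ (i , j) = (1 ℕ.≤ i) × (partAt μ i ℕ.< j) × (j ℕ.≤ partAt λp i)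

content : List ℕ → ℤ → Cell → ℤ
content λp r (i , j) = (((+ j) - (+ i)) ℤ.+ r) - (+ 1) ℤ.+ (+ conjAt λp 1)

EdgeAdj : Cell → Cell → Set
EdgeAdj (i , j) (i' , j') =
  (i ≡ i' × (suc j ≡ j' ⊎ suc j' ≡ j)) ⊎ (j ≡ j' × (suc i ≡ i' ⊎ suc i' ≡ i))

AdjIn : (Cell → Set) → Cell → Cell → Set
AdjIn S x y = S x × S y × EdgeAdj x y

EdgewiseConnected : (Cell → Set) → Set
EdgewiseConnected S = ∀ x y → S x → S y → Star (AdjIn S) x y

IsSkewDiagram : (Cell → Set) → Set
IsSkewDiagram S = Σ (List ℕ) λ α → Σ (List ℕ) λ β →
  IsPartition α × IsPartition β × β ⊆ₚ α ×
  (∀ x → (S x → InSkew α β x) × (InSkew α β x → S x))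

No2x2 : (Cell → Set) → Set
No2x2 S = ∀ i j → ¬ (S (i , j) × S (suc i , j) × S (i , suc j) × S (suc i , suc j))

IsRibbon : (Cell → Set) → Set
IsRibbon S = IsSkewDiagram S × EdgewiseConnected S × No2x2 S

IsBottomLeft : (Cell → Set) → Cell → Set
IsBottomLeft S h = S h × (∀ x → S x → (row x ℕ.≤ row h) × (col h ℕ.≤ col x))

IsTopRight : (Cell → Set) → Cell → Set
IsTopRight S t = S t × (∀ x → S x → (row t ℕ.≤ row x) × (col x ℕ.≤ col t))

above below left right : Cell → Cell
above (i , j) = (i ∸ 1 , j)
below (i , j) = (suc i , j)
left  (i , j) = (i , j ∸ 1)
right (i , j) = (i , suc j)

OnLeft OnBottom OnTop OnRight : List ℕ → List ℕ → Cell → Set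
OnLeft   λp μ x = ¬ InSkew λp μ (left x)
OnBottom λp μ x = ¬ InSkew λp μ (below x)
OnTop    λp μ x = ¬ InSkew λp μ (above x)
OnRight  λp μ x = ¬ InSkew λp μ (right x)

record OuterRibbonDecomposition (λp μ : List ℕ) : Set₁ where
  field
    k      : ℕ
    θ      : Fin k → Cell → Set
    hd     : Fin k → Cell
    tl     : Fin k → Cell
    ribbon : ∀ t → IsRibbon (θ t)
    sub    : ∀ t x → θ t x → InSkew λp μ x
    cover  : ∀ x → InSkew λp μ x → Σ (Fin k) λ t → θ t x
    disj   : ∀ t t' x → θ t x → θ t' x → t ≡ t'
    hd-bl  : ∀ t → IsBottomLeft (θ t) (hd t)
    tl-tr  : ∀ t → IsTopRight (θ t) (tl t)
    hd-per : ∀ t → OnLeft λp μ (hd t) ⊎ OnBottom λp μ (hd t)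
    tl-per : ∀ t → OnTop λp μ (tl t) ⊎ OnRight λp μ (tl t)

data Dir : Set where
  up rt : Dir

open OuterRibbonDecomposition

-- "γ goes d" (with the exceptional rule for the top-right cell of λ/μ)
Goes : (λp μ : List ℕ) → OuterRibbonDecomposition λp μ → Cell → Dir → Set
Goes λp μ D x up = Σ (Fin (k D)) λ t → θ D t x ×
  ((IsTopRight (InSkew λp μ) x → θ D t (below x)) ×
   (¬ IsTopRight (InSkew λp μ) x →
      θ D t (above x) ⊎ (x ≡ tl D t × OnTop λp μ x)))
Goes λp μ D x rt = Σ (Fin (k D)) λ t → θ D t x ×
  ((IsTopRight (InSkew λp μ) x → θ D t (left x)) ×
   (¬ IsTopRight (InSkew λp μ) x →
      θ D t (right x) ⊎ (x ≡ tl D t × OnRight λp μ x)))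

-- dir c is the direction in which the cells of content c go; it is
-- required for every content c such that c + 1 also occurs in λ/μ
-- (exactly the contents used to build the cutting strip Θ(λ/μ)).
IsCuttingDir : (λp μ : List ℕ) (r : ℤ) → OuterRibbonDecomposition λp μ →
               (ℤ → Dir) → Set
IsCuttingDir λp μ r D dir = ∀ x → InSkew λp μ x →
  (Σ Cell λ y → InSkew λp μ y × content λp r y ≡ content λp r x ℤ.+ (+ 1)) →
  Goes λp μ D x (dir (content λp r x))

-- columns of Θ(c, c + n) listed left to right as
-- (content of bottom cell , content of top cell); b is the content of the
-- bottom cell of the current column, c the current content.
stripCols : (ℤ → Dir) → ℤ → ℤ → ℕ → List (ℤ × ℤ)
stripCols dir b c zero = (b , c) ∷ []
stripCols dir b c (suc n) with dir c
... | up = stripCols dir b (c ℤ.+ (+ 1)) n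
... | rt = (b , c) ∷ stripCols dir (c ℤ.+ (+ 1)) (c ℤ.+ (+ 1)) n

-- Θ(p,q) for p ≤ q
ThetaCols : (ℤ → Dir) → ℤ → ℤ → List (ℤ × ℤ)
ThetaCols dir p q = stripCols dir p p ℤ.∣ q - p ∣

height : ℤ × ℤ → ℕ
height (b , t) = suc ℤ.∣ t - b ∣

-- Given column heights h_1..h_K of a ribbon (consecutive columns sharing a
-- row: top of column s and bottom of column s+1), translated so that its
-- last column has top row 1: the list of (ν'_s , κ'_s), i.e. (top row - 1,
-- bottom row) of each column.
ribbonConj : List ℕ → List (ℕ × ℕ)
ribbonConj [] = []
ribbonConj (h ∷ hs) = go (ribbonConj hs)
  where
  go : List (ℕ × ℕ) → List (ℕ × ℕ)
  go []             = (0 , h) ∷ []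
  go ((n , m) ∷ xs) = (m ∸ 1 , m ℕ.+ h ∸ 1) ∷ (n , m) ∷ xs

-- the ribbon Θ(p,q) as a skew diagram κ/ν in columns 1..K
ribbonOuter ribbonInner : List (ℤ × ℤ) → List ℕ
ribbonOuter cs = conjList (map proj₂ (ribbonConj (map height cs)))
ribbonInner cs = conjList (map proj₁ (ribbonConj (map height cs)))

-- a_i (1-indexed); 0 outside 1..n
vat : ∀ {n} → Vec ℤ n → ℕ → ℤ
vat []       _             = + 0
vat (x ∷ xs) zero          = + 0
vat (x ∷ xs) (suc zero)    = x
vat (x ∷ xs) (suc (suc i)) = vat xs (suc i)

IsColumnFlags : (κ ν : List ℕ) (n : ℕ) → Vec ℤ n → Vec ℤ n → Set
IsColumnFlags κ ν n a b = (partAt κ 1 ℕ.≤ n) ×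
  (∀ i → 1 ℕ.≤ i → suc i ℕ.≤ n → conjAt ν i ℕ.< conjAt κ (suc i) →
     (vat a i - vat a (suc i) ℤ.≤ ((+ conjAt ν i) - (+ conjAt ν (suc i))) ℤ.+ (+ 1)) ×
     (vat b i - vat b (suc i) ℤ.≤ ((+ conjAt κ i) - (+ conjAt κ (suc i))) ℤ.+ (+ 1)))

IsRightmostOfContent : List ℕ → List ℕ → ℤ → ℤ → Cell → Set
IsRightmostOfContent λp μ r c x = InSkew λp μ x × content λp r x ≡ c ×
  (∀ y → InSkew λp μ y → content λp r y ≡ c → col y ℕ.≤ col x)

IsLeftmostOfContent : List ℕ → List ℕ → ℤ → ℤ → Cell → Set
IsLeftmostOfContent λp μ r c x = InSkew λp μ x × content λp r x ≡ c ×
  (∀ y → InSkew λp μ y → content λp r y ≡ c → col x ℕ.≤ col y)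

ContentOccurs : List ℕ → List ℕ → ℤ → ℤ → Set
ContentOccurs λp μ r c = Σ Cell λ y → InSkew λp μ y × content λp r y ≡ c

vecOf : {A : Set} → (A → ℤ) → (xs : List A) → Vec ℤ (length xs)
vecOf f []       = []
vecOf f (x ∷ xs) = f x ∷ vecOf f xs

-- a^{ij}_s = a_{col m_s} - (μ'_{col m_s} + 1) + row m_s,  m_s = leftmost cell of content c(γ_s)
inducedA : (μ : List ℕ) {n : ℕ} → Vec ℤ n → (mf : ℤ → Cell) →
           (cs : List (ℤ × ℤ)) → Vec ℤ (length cs)
inducedA μ a mf = vecOf λ bt →
  (vat a (col (mf (proj₂ bt))) - (+ suc (conjAt μ (col (mf (proj₂ bt))))))
    ℤ.+ (+ row (mf (proj₂ bt)))

-- b^{ij}_s = b_{col M_s} - λ'_{col M_s} + row M_s,  M_s = rightmost cell of content c(δ_s)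
inducedB : (λp : List ℕ) {n : ℕ} → Vec ℤ n → (Mf : ℤ → Cell) →
           (cs : List (ℤ × ℤ)) → Vec ℤ (length cs)
inducedB λp b Mf = vecOf λ bt →
  (vat b (col (Mf (proj₁ bt))) - (+ conjAt λp (col (Mf (proj₁ bt)))))
    ℤ.+ (+ row (Mf (proj₁ bt)))

-- The column-flag inequality a_i − a_{i+1} ≤ ν'_i − ν'_{i+1} + 1 says that the potential
-- a_i − ν'_i + i does not decrease from column i to column i + 1. For the flags of λ/μ this holds
-- at every column spanned by the diagram: connectivity provides a horizontal edge from column i
-- to column i + 1, which forces μ'_i < λ'_{i+1}. Up to a constant, the induced flag a^{ij}_s is
-- the potential at col m_s minus the content of m_s, and leftmost cells of increasing contents lie
-- in weakly increasing columns (slide along a diagonal inside the skew shape). Hence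
-- a^{ij}_s − a^{ij}_{s+1} ≤ c(γ_{s+1}) − c(γ_s), the height of column s + 1 of the ribbon, which is
-- exactly ν'_s − ν'_{s+1} + 1 for the ribbon. Rightmost cells and the bottom contents of the
-- columns give the bound for b in the same way.

module Submission where

open import Defs
open import Data.Nat as ℕ using (ℕ; zero; suc; z≤n; s≤s; _∸_; _≤?_)
import Data.Nat.Properties as ℕₚ
open import Data.Integer as ℤ using (ℤ; +_; _+_; _-_; _≤_; _<_; +≤+; +<+)
import Data.Integer.Properties as ℤₚ
open import Data.Integer.Tactic.RingSolver using (solve-∀)
import Data.Nat.Tactic.RingSolver as ℕ-Ring
open import Data.Fin using (Fin)
open import Data.List using (List; []; _∷_; length; filter; map; applyUpTo)
import Data.List.Properties as Listₚ
open import Data.List.Relation.Unary.All as All using (All; []; _∷_)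
open import Data.List.Relation.Unary.Linked as Linked using (Linked; []; [-]; _∷_)
open import Data.List.Relation.Unary.Linked.Properties using (Linked⇒All)
open import Data.Vec using (Vec)
open import Data.Product using (∃; ∃₂; _×_; _,_; proj₁; proj₂)
open import Data.Sum using (inj₁; inj₂)
open import Function using (_∘_; flip)
open import Relation.Nullary using (yes; no; contradiction)
open import Relation.Unary using (Decidable)
open import Relation.Binary.PropositionalEquality
open import Relation.Binary.Construct.Closure.ReflexiveTransitive using (Star; ε; _◅_)
open OuterRibbonDecomposition

-- Partitions and their conjugates

partAt-≤-head : ∀ {x xs} → IsPartition (x ∷ xs) → ∀ i → partAt (x ∷ xs) i ℕ.≤ x
partAt-≤-head _ zero = z≤n
partAt-≤-head _ (suc zero) = ℕₚ.≤-refl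
partAt-≤-head {xs = []} _ (suc (suc i)) = z≤n
partAt-≤-head {xs = y ∷ ys} (x≥y ∷ p) (suc (suc i)) = ℕₚ.≤-trans (partAt-≤-head p (suc i)) x≥y

partAt-antitone : ∀ {p} → IsPartition p → ∀ {i i'} → 1 ℕ.≤ i → i ℕ.≤ i' →
                  partAt p i' ℕ.≤ partAt p i
partAt-antitone {[]} _ _ _ = z≤n
partAt-antitone {x ∷ xs} p {suc zero} {i'} _ _ = partAt-≤-head p i'
partAt-antitone {x ∷ xs} p {suc (suc i)} {suc (suc i')} _ (s≤s (s≤s i≤i')) =
  partAt-antitone (Linked.tail p) (s≤s z≤n) (s≤s i≤i')

conjAt-∷-accept : ∀ {j x} xs → j ℕ.≤ x → conjAt (x ∷ xs) j ≡ suc (conjAt xs j)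
conjAt-∷-accept {j} xs j≤x = cong length (Listₚ.filter-accept (j ≤?_) j≤x)

conjAt-∷-≤ : ∀ {j} x xs → conjAt (x ∷ xs) j ℕ.≤ suc (conjAt xs j)
conjAt-∷-≤ {j} x xs with j ≤? x
... | yes j≤x = ℕₚ.≤-reflexive (conjAt-∷-accept xs j≤x)
... | no j≰x  = ℕₚ.≤-trans (ℕₚ.≤-reflexive (cong length (Listₚ.filter-reject (j ≤?_) j≰x)))
                           (ℕₚ.n≤1+n _)

conjAt-head< : ∀ {x xs j} → IsPartition (x ∷ xs) → x ℕ.< j → conjAt (x ∷ xs) j ≡ 0
conjAt-head< {x} {j = j} p x<j = cong length (Listₚ.filter-none (j ≤?_)
  (All.map (λ y≤x j≤y → ℕₚ.<⇒≱ x<j (ℕₚ.≤-trans j≤y y≤x)) (Linked⇒All (flip ℕₚ.≤-trans) ℕₚ.≤-refl p)))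

≤partAt⇒≤conjAt : ∀ {p} → IsPartition p → ∀ {i j} → 1 ℕ.≤ i → 1 ℕ.≤ j →
                  j ℕ.≤ partAt p i → i ℕ.≤ conjAt p j
≤partAt⇒≤conjAt {[]} _ {j = suc _} _ _ ()
≤partAt⇒≤conjAt {x ∷ xs} _ {suc zero} _ _ j≤x =
  subst (1 ℕ.≤_) (sym (conjAt-∷-accept xs j≤x)) (s≤s z≤n)
≤partAt⇒≤conjAt {x ∷ xs} p {suc (suc i)} _ 1≤j j≤pᵢ =
  subst (suc (suc i) ℕ.≤_) (sym (conjAt-∷-accept xs (ℕₚ.≤-trans j≤pᵢ (partAt-≤-head p (suc (suc i))))))
    (s≤s (≤partAt⇒≤conjAt (Linked.tail p) (s≤s z≤n) 1≤j j≤pᵢ))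

partAt<⇒conjAt< : ∀ {p} → IsPartition p → ∀ {i j} → 1 ℕ.≤ i →
                  partAt p i ℕ.< j → conjAt p j ℕ.< i
partAt<⇒conjAt< {[]} _ 1≤i _ = 1≤i
partAt<⇒conjAt< {x ∷ xs} p {suc zero} _ x<j = ℕₚ.≤-reflexive (cong suc (conjAt-head< p x<j))
partAt<⇒conjAt< {x ∷ xs} p {suc (suc i)} _ pᵢ<j =
  ℕₚ.≤-<-trans (conjAt-∷-≤ x xs) (s≤s (partAt<⇒conjAt< (Linked.tail p) (s≤s z≤n) pᵢ<j))

length-filter-prefix : ∀ {P : ℕ → Set} (P? : Decidable P) (f : ℕ → ℕ) N m → m ℕ.≤ N →
  (∀ j → j ℕ.< N → P (f j) → j ℕ.< m) → (∀ j → j ℕ.< m → P (f j)) →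
  length (filter P? (applyUpTo f N)) ≡ m
length-filter-prefix P? f zero zero _ _ _ = refl
length-filter-prefix P? f (suc N) zero _ P⇒<m _ =
  trans (cong length (Listₚ.filter-reject P? (λ P₀ → ℕₚ.n≮0 (P⇒<m 0 (s≤s z≤n) P₀))))
        (length-filter-prefix P? (f ∘ suc) N zero z≤n
          (λ j j<N P₁ → contradiction (P⇒<m (suc j) (s≤s j<N) P₁) ℕₚ.n≮0) (λ _ ()))
length-filter-prefix P? f (suc N) (suc m) (s≤s m≤N) P⇒<m <m⇒P =
  trans (cong length (Listₚ.filter-accept P? (<m⇒P 0 (s≤s z≤n))))
        (cong suc (length-filter-prefix P? (f ∘ suc) N m m≤N
          (λ j j<N P₁ → ℕₚ.≤-pred (P⇒<m (suc j) (s≤s j<N) P₁))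
          (λ j j<m → <m⇒P (suc j) (s≤s j<m))))

conjAt-conjList : ∀ {p} → IsPartition p → ∀ {i} → 1 ℕ.≤ i → conjAt (conjList p) i ≡ partAt p i
conjAt-conjList {p} P {i} 1≤i =
  trans (cong (length ∘ filter (i ≤?_)) (Listₚ.map-upTo (λ j → conjAt p (suc j)) (partAt p 1)))
    (length-filter-prefix (i ≤?_) (λ j → conjAt p (suc j)) (partAt p 1) (partAt p i)
      (partAt-antitone P ℕₚ.≤-refl 1≤i)
      (λ j _ i≤p'ⱼ → ℕₚ.≰⇒> λ pᵢ≤j → ℕₚ.<⇒≱ (partAt<⇒conjAt< P 1≤i (s≤s pᵢ≤j)) i≤p'ⱼ)
      (λ j j<pᵢ → ≤partAt⇒≤conjAt P 1≤i (s≤s z≤n) j<pᵢ))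

partAt-conjList-1 : ∀ p → partAt (conjList p) 1 ℕ.≤ length p
partAt-conjList-1 p with partAt p 1
... | zero  = z≤n
... | suc _ = Listₚ.length-filter (1 ≤?_) p

-- Ribbons given by their column heights

ribbonInnerConj ribbonOuterConj : List (ℤ × ℤ) → List ℕ
ribbonInnerConj cs = map proj₁ (ribbonConj (map height cs))
ribbonOuterConj cs = map proj₂ (ribbonConj (map height cs))

length-ribbonConj : ∀ hs → length (ribbonConj hs) ≡ length hs
length-ribbonConj [] = refl
length-ribbonConj (h ∷ hs) with ribbonConj hs | length-ribbonConj hs
... | []    | eq = cong suc eq
... | _ ∷ _ | eq = cong suc eq

length-ribbonOuterConj : ∀ cs → length (ribbonOuterConj cs) ≡ length cs
length-ribbonOuterConj cs = begin
  length (ribbonOuterConj cs)             ≡⟨ Listₚ.length-map proj₂ (ribbonConj (map height cs)) ⟩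
  length (ribbonConj (map height cs))     ≡⟨ length-ribbonConj (map height cs) ⟩
  length (map height cs)                  ≡⟨ Listₚ.length-map height cs ⟩
  length cs                               ∎
  where open ≡-Reasoning

ribbonConj-head : ∀ c cs → ∃₂ λ n rest → ribbonConj (map height (c ∷ cs)) ≡ (n , n ℕ.+ height c) ∷ rest
ribbonConj-head c [] = 0 , [] , refl
ribbonConj-head c (d ∷ cs) with ribbonConj (map height (d ∷ cs)) | ribbonConj-head d cs
... | _ | n , rest , refl =
  n ℕ.+ height d ∸ 1 , (n , n ℕ.+ height d) ∷ rest ,
  cong (λ κ₁ → (n ℕ.+ height d ∸ 1 , κ₁) ∷ (n , n ℕ.+ height d) ∷ rest)
       (ℕₚ.+-∸-comm (height c) (ℕₚ.≤-trans (s≤s z≤n) (ℕₚ.m≤n+m (height d) n)))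

m+[1+k]∸1≡m+k : ∀ m k → m ℕ.+ suc k ∸ 1 ≡ m ℕ.+ k
m+[1+k]∸1≡m+k m k = cong (_∸ 1) (ℕₚ.+-suc m k)

m≤m+[1+k]∸1 : ∀ m k → m ℕ.≤ m ℕ.+ suc k ∸ 1
m≤m+[1+k]∸1 m k = subst (m ℕ.≤_) (sym (m+[1+k]∸1≡m+k m k)) (ℕₚ.m≤m+n m k)

ribbonInnerConj-isPartition : ∀ cs → IsPartition (ribbonInnerConj cs)
ribbonInnerConj-isPartition [] = []
ribbonInnerConj-isPartition (c ∷ []) = [-]
ribbonInnerConj-isPartition (c ∷ d ∷ cs)
  with ribbonConj (map height (d ∷ cs)) | ribbonConj-head d cs | ribbonInnerConj-isPartition (d ∷ cs)
... | _ | n , rest , refl | ih = m≤m+[1+k]∸1 n _ ∷ ih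

ribbonOuterConj-isPartition : ∀ cs → IsPartition (ribbonOuterConj cs)
ribbonOuterConj-isPartition [] = []
ribbonOuterConj-isPartition (c ∷ []) = [-]
ribbonOuterConj-isPartition (c ∷ d ∷ cs)
  with ribbonConj (map height (d ∷ cs)) | ribbonConj-head d cs | ribbonOuterConj-isPartition (d ∷ cs)
... | _ | n , rest , refl | ih = m≤m+[1+k]∸1 (n ℕ.+ height d) _ ∷ ih

[m+[1+k]∸1]-m+1≡1+k : ∀ m k → (+ (m ℕ.+ suc k ∸ 1) - + m) + + 1 ≡ + suc k
[m+[1+k]∸1]-m+1≡1+k m k =
  trans (cong (λ t → (+ t - + m) + + 1) (m+[1+k]∸1≡m+k m k)) (cancel (+ m) (+ k))
  where
  cancel : ∀ a b → ((a + b) - a) + + 1 ≡ + 1 + b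
  cancel = solve-∀

-- For consecutive columns x, y of a ribbon, ν'_s − ν'_{s+1} + 1 = height y and
-- κ'_s − κ'_{s+1} + 1 = height x.
ColumnStep : (fa fb : ℤ × ℤ → ℤ) → ℤ × ℤ → ℤ × ℤ → Set
ColumnStep fa fb x y = (fa x - fa y ≤ + height y) × (fb x - fb y ≤ + height x)

ribbon-flagStep : ∀ fa fb cs → Linked (ColumnStep fa fb) cs →
  ∀ s → 1 ℕ.≤ s → suc s ℕ.≤ length cs →
  (vat (vecOf fa cs) s - vat (vecOf fa cs) (suc s)
     ≤ (+ partAt (ribbonInnerConj cs) s - + partAt (ribbonInnerConj cs) (suc s)) + + 1) ×
  (vat (vecOf fb cs) s - vat (vecOf fb cs) (suc s)
     ≤ (+ partAt (ribbonOuterConj cs) s - + partAt (ribbonOuterConj cs) (suc s)) + + 1)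
ribbon-flagStep fa fb (c ∷ []) _ (suc s) _ (s≤s ())
ribbon-flagStep fa fb (c ∷ d ∷ cs) (step ∷ _) (suc zero) _ _
  with ribbonConj (map height (d ∷ cs)) | ribbonConj-head d cs
... | _ | n , rest , refl =
  ℤₚ.≤-trans (proj₁ step) (ℤₚ.≤-reflexive (sym ([m+[1+k]∸1]-m+1≡1+k n _))) ,
  ℤₚ.≤-trans (proj₂ step) (ℤₚ.≤-reflexive (sym ([m+[1+k]∸1]-m+1≡1+k (n ℕ.+ height d) _)))
ribbon-flagStep fa fb (c ∷ d ∷ cs) (_ ∷ steps) (suc (suc s)) _ (s≤s s<K)
  with ribbonConj (map height (d ∷ cs)) | ribbonConj-head d cs
     | ribbon-flagStep fa fb (d ∷ cs) steps (suc s) (s≤s z≤n) s<K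
... | _ | n , rest , refl | ih = ih

ribbon-columnFlags : ∀ fa fb cs → Linked (ColumnStep fa fb) cs →
  IsColumnFlags (ribbonOuter cs) (ribbonInner cs) (length cs) (vecOf fa cs) (vecOf fb cs)
ribbon-columnFlags fa fb cs steps =
  subst (partAt (ribbonOuter cs) 1 ℕ.≤_) (length-ribbonOuterConj cs)
        (partAt-conjList-1 (ribbonOuterConj cs)) ,
  flagStep
  where
  flagStep : ∀ s → 1 ℕ.≤ s → suc s ℕ.≤ length cs →
    conjAt (ribbonInner cs) s ℕ.< conjAt (ribbonOuter cs) (suc s) →
    (vat (vecOf fa cs) s - vat (vecOf fa cs) (suc s)
       ≤ (+ conjAt (ribbonInner cs) s - + conjAt (ribbonInner cs) (suc s)) + + 1) ×
    (vat (vecOf fb cs) s - vat (vecOf fb cs) (suc s)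
       ≤ (+ conjAt (ribbonOuter cs) s - + conjAt (ribbonOuter cs) (suc s)) + + 1)
  flagStep s 1≤s s<K _
    rewrite conjAt-conjList (ribbonInnerConj-isPartition cs) 1≤s
          | conjAt-conjList (ribbonInnerConj-isPartition cs) (s≤s (z≤n {s}))
          | conjAt-conjList (ribbonOuterConj-isPartition cs) 1≤s
          | conjAt-conjList (ribbonOuterConj-isPartition cs) (s≤s (z≤n {s}))
    = ribbon-flagStep fa fb cs steps s 1≤s s<K

-- The columns of Θ(p,q)

Within : ℤ → ℤ → ℤ × ℤ → Set
Within p q (β , τ) = p ≤ β × β ≤ τ × τ ≤ q

Abutting : ℤ × ℤ → ℤ × ℤ → Set
Abutting (_ , τ) (β′ , _) = β′ ≡ τ + + 1

stripCols-head : ∀ dir b c n → ∃₂ λ t rest → stripCols dir b c n ≡ (b , t) ∷ rest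
stripCols-head dir b c zero = c , [] , refl
stripCols-head dir b c (suc n) with dir c
... | up = stripCols-head dir b (c + + 1) n
... | rt = c , _ , refl

stripCols-abutting : ∀ dir b c n → Linked Abutting (stripCols dir b c n)
stripCols-abutting dir b c zero = [-]
stripCols-abutting dir b c (suc n) with dir c
... | up = stripCols-abutting dir b (c + + 1) n
... | rt with stripCols dir (c + + 1) (c + + 1) n | stripCols-head dir (c + + 1) (c + + 1) n
           | stripCols-abutting dir (c + + 1) (c + + 1) n
...        | _ | _ , _ , refl | abut = refl ∷ abut

stripCols-within : ∀ dir {p q} b c n → p ≤ b → b ≤ c → c + + n ≤ q →
                   All (Within p q) (stripCols dir b c n)
stripCols-within dir b c zero p≤b b≤c c≤q =
  (p≤b , b≤c , ℤₚ.≤-trans (ℤₚ.i≤i+j c (+ 0)) c≤q) ∷ []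
stripCols-within dir b c (suc n) p≤b b≤c c+n≤q with dir c
... | up = stripCols-within dir b (c + + 1) n p≤b (ℤₚ.≤-trans b≤c (ℤₚ.i≤i+j c (+ 1)))
             (ℤₚ.≤-trans (ℤₚ.≤-reflexive (ℤₚ.+-assoc c (+ 1) (+ n))) c+n≤q)
... | rt = (p≤b , b≤c , ℤₚ.≤-trans (ℤₚ.i≤i+j c (+ suc n)) c+n≤q)
         ∷ stripCols-within dir (c + + 1) (c + + 1) n
             (ℤₚ.≤-trans p≤b (ℤₚ.≤-trans b≤c (ℤₚ.i≤i+j c (+ 1)))) ℤₚ.≤-refl
             (ℤₚ.≤-trans (ℤₚ.≤-reflexive (ℤₚ.+-assoc c (+ 1) (+ n))) c+n≤q)

All∧Linked⇒Linked : ∀ {A : Set} {P : A → Set} {R : A → A → Set} {xs} →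
                    All P xs → Linked R xs → Linked (λ x y → P x × P y × R x y) xs
All∧Linked⇒Linked [] [] = []
All∧Linked⇒Linked (_ ∷ []) [-] = [-]
All∧Linked⇒Linked (px ∷ py ∷ pxs) (r ∷ rs) = (px , py , r) ∷ All∧Linked⇒Linked (py ∷ pxs) rs

ThetaCols-consecutive : ∀ dir {p q} → p ≤ q →
  Linked (λ x y → Within p q x × Within p q y × Abutting x y) (ThetaCols dir p q)
ThetaCols-consecutive dir {p} {q} p≤q =
  All∧Linked⇒Linked
    (stripCols-within dir p p ℤ.∣ q - p ∣ ℤₚ.≤-refl ℤₚ.≤-refl (ℤₚ.≤-reflexive p+∣q-p∣≡q))
    (stripCols-abutting dir p p ℤ.∣ q - p ∣)
  where
  p+[q-p]≡q : ∀ p q → p + (q - p) ≡ q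
  p+[q-p]≡q = solve-∀
  p+∣q-p∣≡q : p + + ℤ.∣ q - p ∣ ≡ q
  p+∣q-p∣≡q = trans (cong (λ k → p + k) (ℤₚ.0≤i⇒+∣i∣≡i (ℤₚ.i≤j⇒0≤j-i p≤q))) (p+[q-p]≡q p q)

height≡ : ∀ {β τ} → β ≤ τ → + height (β , τ) ≡ (τ + + 1) - β
height≡ {β} {τ} β≤τ = trans (cong (λ k → + 1 + k) (ℤₚ.0≤i⇒+∣i∣≡i (ℤₚ.i≤j⇒0≤j-i β≤τ))) (rearrange τ β)
  where
  rearrange : ∀ τ β → + 1 + (τ - β) ≡ (τ + + 1) - β
  rearrange = solve-∀

content-right : ∀ la r i j → content la r (i , suc j) ≡ + 1 + content la r (i , j)
content-right la r i j = shift (+ j) (+ i) r (+ conjAt la 1)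
  where
  shift : ∀ J I r L → ((((+ 1 + J) - I) + r) - + 1) + L ≡ + 1 + ((((J - I) + r) - + 1) + L)
  shift = solve-∀

content-above : ∀ la r i j → content la r (i , j) ≡ + 1 + content la r (suc i , j)
content-above la r i j = shift (+ j) (+ i) r (+ conjAt la 1)
  where
  shift : ∀ J I r L → (((J - I) + r) - + 1) + L ≡ + 1 + ((((J - (+ 1 + I)) + r) - + 1) + L)
  shift = solve-∀

content-sub : ∀ la r x y →
  content la r y - content la r x ≡ + (col y ℕ.+ row x) - + (col x ℕ.+ row y)
content-sub la r (i , j) (i′ , j′) = cancel (+ j) (+ i) (+ j′) (+ i′) r (+ conjAt la 1)
  where
  cancel : ∀ J I J′ I′ r L →
    ((((J′ - I′) + r) - + 1) + L) - ((((J - I) + r) - + 1) + L) ≡ (J′ + I) - (J + I′)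
  cancel = solve-∀

x≡1+y⇒y≤1+x : ∀ {x y} → x ≡ + 1 + y → y ≤ + 1 + x
x≡1+y⇒y≤1+x {x} {y} x≡1+y =
  ℤₚ.≤-trans (ℤₚ.i≤suc[i] y) (ℤₚ.≤-trans (ℤₚ.≤-reflexive (sym x≡1+y)) (ℤₚ.i≤suc[i] x))

content-adjacent : ∀ la r {u v} → EdgeAdj u v → content la r v ≤ + 1 + content la r u
content-adjacent la r {i , j} (inj₁ (refl , inj₁ refl)) = ℤₚ.≤-reflexive (content-right la r i j)
content-adjacent la r {i , _} (inj₁ (refl , inj₂ refl)) = x≡1+y⇒y≤1+x (content-right la r i _)
content-adjacent la r {i , j} (inj₂ (refl , inj₁ refl)) = x≡1+y⇒y≤1+x (content-above la r i j)
content-adjacent la r {_ , j} (inj₂ (refl , inj₂ refl)) = ℤₚ.≤-reflexive (content-above la r _ j)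

content-≤⇒ : ∀ la r x y → content la r x ≤ content la r y →
             col x ℕ.+ row y ℕ.≤ col y ℕ.+ row x
content-≤⇒ la r x y x≤y = ℤₚ.drop‿+≤+ (ℤₚ.0≤i-j⇒j≤i
  (subst (+ 0 ≤_) (content-sub la r x y) (ℤₚ.i≤j⇒0≤j-i x≤y)))

content-≡⇐ : ∀ la r x y → col y ℕ.+ row x ≡ col x ℕ.+ row y → content la r x ≡ content la r y
content-≡⇐ la r x y eq = sym (ℤₚ.i-j≡0⇒i≡j _ _
  (trans (content-sub la r x y)
         (trans (cong (λ k → + k - + (col x ℕ.+ row y)) eq) (ℤₚ.+-inverseʳ (+ (col x ℕ.+ row y))))))

flagPotential : (ℕ → ℤ) → (ℕ → ℕ) → ℕ → ℤ
flagPotential A B j = (A j - + B j) + + j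

flagStep⇒potential-≤ : ∀ A B i → A i - A (suc i) ≤ (+ B i - + B (suc i)) + + 1 →
                       flagPotential A B i ≤ flagPotential A B (suc i)
flagStep⇒potential-≤ A B i step = ℤₚ.0≤i-j⇒j≤i
  (subst (+ 0 ≤_) (rearrange (A i) (A (suc i)) (+ B i) (+ B (suc i)) (+ i)) (ℤₚ.i≤j⇒0≤j-i step))
  where
  rearrange : ∀ a a′ b b′ i → ((b - b′) + + 1) - (a - a′) ≡ ((a′ - b′) + (+ 1 + i)) - ((a - b) + i)
  rearrange = solve-∀

stepwise-monotone : ∀ (f : ℕ → ℤ) {j j′} → j ℕ.≤ j′ →
                    (∀ i → j ℕ.≤ i → i ℕ.< j′ → f i ≤ f (suc i)) → f j ≤ f j′
stepwise-monotone f {j′ = zero} z≤n _ = ℤₚ.≤-refl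
stepwise-monotone f {j′ = suc k} j≤1+k step with ℕₚ.m≤n⇒m<n∨m≡n j≤1+k
... | inj₂ refl = ℤₚ.≤-refl
... | inj₁ (s≤s j≤k) = ℤₚ.≤-trans
  (stepwise-monotone f j≤k (λ i j≤i i<k → step i j≤i (ℕₚ.m≤n⇒m≤1+n i<k)))
  (step k j≤k ℕₚ.≤-refl)

-- cellFlag (vat a) (conjAt μ) 1 m and cellFlag (vat b) (conjAt λ) 0 M are the paper's
-- a_{col m} − (μ'_{col m} + 1) + row m and b_{col M} − λ'_{col M} + row M.
cellFlag : (ℕ → ℤ) → (ℕ → ℕ) → ℕ → Cell → ℤ
cellFlag A B e x = (A (col x) - + (e ℕ.+ B (col x))) + + row x

cellFlag-lipschitz : ∀ la r A B e x y → flagPotential A B (col x) ≤ flagPotential A B (col y) →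
                     cellFlag A B e x - cellFlag A B e y ≤ content la r y - content la r x
cellFlag-lipschitz la r A B e x y Px≤Py = begin
  cellFlag A B e x - cellFlag A B e y
    ≡⟨ rearrange (A (col x)) (A (col y)) (+ B (col x)) (+ B (col y)) (+ e)
                 (+ col x) (+ col y) (+ row x) (+ row y) ⟩
  (flagPotential A B (col x) - flagPotential A B (col y)) + diagonalGap
    ≤⟨ ℤₚ.+-monoˡ-≤ diagonalGap (ℤₚ.i≤j⇒i-j≤0 Px≤Py) ⟩
  + 0 + diagonalGap
    ≡⟨ ℤₚ.+-identityˡ diagonalGap ⟩
  diagonalGap
    ≡⟨ content-sub la r x y ⟨
  content la r y - content la r x ∎
  where
  open ℤₚ.≤-Reasoning
  diagonalGap : ℤ
  diagonalGap = + (col y ℕ.+ row x) - + (col x ℕ.+ row y)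
  rearrange : ∀ ax ay bx by e cx cy rx ry →
    ((ax - (e + bx)) + rx) - ((ay - (e + by)) + ry)
      ≡ (((ax - bx) + cx) - ((ay - by) + cy)) + ((cy + rx) - (cx + ry))
  rearrange = solve-∀

-- Connected skew diagrams

Star-crossing : ∀ {A : Set} {R : A → A → Set} (f : A → ℤ) {t x y} → Star R x y →
                f x < t → t ≤ f y → ∃₂ λ u v → R u v × f u < t × t ≤ f v
Star-crossing f ε fx<t t≤fy = contradiction t≤fy (ℤₚ.<⇒≱ fx<t)
Star-crossing f {t} (_◅_ {j = v} xRv v⋆y) fx<t t≤fy with t ℤₚ.≤? f v
... | yes t≤fv = _ , _ , xRv , fx<t , t≤fv
... | no t≰fv  = Star-crossing f v⋆y (ℤₚ.≰⇒> t≰fv) t≤fy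

module _ {la mu : List ℕ} (λ-partition : IsPartition la) (μ-partition : IsPartition mu) where

  InSkew-between : ∀ {i₁ j₁ i₂ j₂ i j} → InSkew la mu (i₁ , j₁) → InSkew la mu (i₂ , j₂) →
                   i₁ ℕ.≤ i → i ℕ.≤ i₂ → j₁ ℕ.≤ j → j ℕ.≤ j₂ → InSkew la mu (i , j)
  InSkew-between {i = i} (1≤i₁ , μ<j₁ , _) (_ , _ , j₂≤λ) i₁≤i i≤i₂ j₁≤j j≤j₂ =
    1≤i ,
    ℕₚ.<-≤-trans (ℕₚ.≤-<-trans (partAt-antitone μ-partition 1≤i₁ i₁≤i) μ<j₁) j₁≤j ,
    ℕₚ.≤-trans j≤j₂ (ℕₚ.≤-trans j₂≤λ (partAt-antitone λ-partition 1≤i i≤i₂))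
    where
    1≤i : 1 ℕ.≤ i
    1≤i = ℕₚ.≤-trans 1≤i₁ i₁≤i

  diagonal-slide : ∀ r {x y} → InSkew la mu x → InSkew la mu y → col x ℕ.≤ col y →
    content la r y ≤ content la r x →
    (∃ λ z → InSkew la mu z × col z ≡ col x × content la r z ≡ content la r y) ×
    (∃ λ z → InSkew la mu z × col z ≡ col y × content la r z ≡ content la r x)
  diagonal-slide r {i , j} {i′ , j′} x∈ y∈ j≤j′ y≤x
    with e , refl ← ℕₚ.m≤n⇒∃[o]m+o≡n j≤j′
    with d , refl ← ℕₚ.m≤n⇒∃[o]m+o≡n (ℕₚ.+-cancelˡ-≤ j (e ℕ.+ i) i′
           (subst (ℕ._≤ j ℕ.+ i′) (ℕₚ.+-assoc j e i) (content-≤⇒ la r (i′ , j ℕ.+ e) (i , j) y≤x)))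
    = ((i ℕ.+ d , j) ,
        InSkew-between x∈ y∈ (ℕₚ.m≤m+n i d) (ℕₚ.+-monoˡ-≤ d (ℕₚ.m≤n+m i e)) ℕₚ.≤-refl (ℕₚ.m≤m+n j e) ,
        refl , content-≡⇐ la r (i ℕ.+ d , j) (e ℕ.+ i ℕ.+ d , j ℕ.+ e) (sameDiagonal₁ j e i d))
    , ((i ℕ.+ e , j ℕ.+ e) ,
        InSkew-between x∈ y∈ (ℕₚ.m≤m+n i e) (ℕₚ.≤-trans (ℕₚ.≤-reflexive (ℕₚ.+-comm i e)) (ℕₚ.m≤m+n (e ℕ.+ i) d))
          (ℕₚ.m≤m+n j e) ℕₚ.≤-refl ,
        refl , content-≡⇐ la r (i ℕ.+ e , j ℕ.+ e) (i , j) (sameDiagonal₂ j e i))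
    where
    sameDiagonal₁ : ∀ j e i d → j ℕ.+ e ℕ.+ (i ℕ.+ d) ≡ j ℕ.+ (e ℕ.+ i ℕ.+ d)
    sameDiagonal₁ = ℕ-Ring.solve-∀
    sameDiagonal₂ : ∀ j e i → j ℕ.+ (i ℕ.+ e) ≡ j ℕ.+ e ℕ.+ i
    sameDiagonal₂ = ℕ-Ring.solve-∀

  leftmost-col-mono : ∀ r {c m y} → IsLeftmostOfContent la mu r c m → InSkew la mu y →
                      c ≤ content la r y → col m ℕ.≤ col y
  leftmost-col-mono r {m = m} {y} (m∈ , refl , leftmost) y∈ c≤y with ℕₚ.≤-total (col m) (col y)
  ... | inj₁ m≤y = m≤y
  ... | inj₂ y≤m with diagonal-slide r y∈ m∈ y≤m c≤y
  ...   | (z , z∈ , refl , z≡m) , _ = leftmost z z∈ z≡m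

  rightmost-col-mono : ∀ r {c M y} → IsRightmostOfContent la mu r c M → InSkew la mu y →
                       content la r y ≤ c → col y ℕ.≤ col M
  rightmost-col-mono r {M = M} {y} (M∈ , refl , rightmost) y∈ y≤c with ℕₚ.≤-total (col y) (col M)
  ... | inj₁ y≤M = y≤M
  ... | inj₂ M≤y with diagonal-slide r M∈ y∈ M≤y y≤c
  ...   | _ , (z , z∈ , refl , z≡M) = rightmost z z∈ z≡M

  module _ (connected : EdgewiseConnected (InSkew la mu)) where

    contentOccurs-between : ∀ r {x y c} → InSkew la mu x → InSkew la mu y →
      content la r x ≤ c → c ≤ content la r y → ContentOccurs la mu r c
    contentOccurs-between r {x} {y} {c} x∈ y∈ x≤c c≤y with c ℤₚ.≤? content la r x
    ... | yes c≤x = x , x∈ , ℤₚ.≤-antisym x≤c c≤x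
    ... | no c≰x with Star-crossing (content la r) (connected x y x∈ y∈) (ℤₚ.≰⇒> c≰x) c≤y
    ...   | u , v , (_ , v∈ , u~v) , u<c , c≤v =
      v , v∈ , ℤₚ.≤-antisym (ℤₚ.≤-trans (content-adjacent la r u~v) (ℤₚ.i<j⇒suc[i]≤j u<c)) c≤v

    conjAt-<-between : ∀ {x y i} → InSkew la mu x → InSkew la mu y →
      col x ℕ.≤ i → i ℕ.< col y → conjAt mu i ℕ.< conjAt la (suc i)
    conjAt-<-between {x} {y} {i} x∈ y∈ x≤i i<y
      with Star-crossing (+_ ∘ col) (connected x y x∈ y∈) (+<+ (s≤s x≤i)) (+≤+ i<y)
    ... | u , v , (u∈ , v∈ , u~v) , +<+ (s≤s u≤i) , +≤+ i<v = crossing u∈ v∈ u~v u≤i i<v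
      where
      crossing : ∀ {u v} → InSkew la mu u → InSkew la mu v → EdgeAdj u v →
                 col u ℕ.≤ i → i ℕ.< col v → conjAt mu i ℕ.< conjAt la (suc i)
      crossing (1≤r , μ<j , _) (_ , _ , j+1≤λ) (inj₁ (refl , inj₁ refl)) j≤i i<j+1 =
        ℕₚ.<-≤-trans (partAt<⇒conjAt< μ-partition 1≤r (ℕₚ.<-≤-trans μ<j j≤i))
                     (≤partAt⇒≤conjAt λ-partition 1≤r (s≤s z≤n) (ℕₚ.≤-trans i<j+1 j+1≤λ))
      crossing _ _ (inj₁ (refl , inj₂ refl)) j+1≤i i<j =
        contradiction (ℕₚ.<-trans j+1≤i i<j) (ℕₚ.<-irrefl refl)
      crossing _ _ (inj₂ (refl , _)) j≤i i<j = contradiction (ℕₚ.≤-<-trans j≤i i<j) (ℕₚ.<-irrefl refl)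

    module _ {n a b} (flags : IsColumnFlags la mu n a b) where

      columnFlags-between : ∀ {x y i} → InSkew la mu x → InSkew la mu y → col x ℕ.≤ i → i ℕ.< col y →
        (vat a i - vat a (suc i) ≤ (+ conjAt mu i - + conjAt mu (suc i)) + + 1) ×
        (vat b i - vat b (suc i) ≤ (+ conjAt la i - + conjAt la (suc i)) + + 1)
      columnFlags-between x∈@(_ , μ<x , _) y∈@(1≤row , _ , y≤λ) x≤i i<y =
        proj₂ flags _ (ℕₚ.≤-trans (ℕₚ.≤-trans (s≤s z≤n) μ<x) x≤i)
          (ℕₚ.≤-trans i<y (ℕₚ.≤-trans y≤λ (ℕₚ.≤-trans (partAt-antitone λ-partition (s≤s z≤n) 1≤row)
                                                        (proj₁ flags))))
          (conjAt-<-between x∈ y∈ x≤i i<y)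

      flagPotentials-mono : ∀ {x y} → InSkew la mu x → InSkew la mu y → col x ℕ.≤ col y →
        (flagPotential (vat a) (conjAt mu) (col x) ≤ flagPotential (vat a) (conjAt mu) (col y)) ×
        (flagPotential (vat b) (conjAt la) (col x) ≤ flagPotential (vat b) (conjAt la) (col y))
      flagPotentials-mono x∈ y∈ x≤y =
        stepwise-monotone _ x≤y (λ i x≤i i<y →
          flagStep⇒potential-≤ (vat a) (conjAt mu) i (proj₁ (columnFlags-between x∈ y∈ x≤i i<y))) ,
        stepwise-monotone _ x≤y (λ i x≤i i<y →
          flagStep⇒potential-≤ (vat b) (conjAt la) i (proj₂ (columnFlags-between x∈ y∈ x≤i i<y)))

      leftmostFlag-lipschitz : ∀ r {c c′ m m′} →
        IsLeftmostOfContent la mu r c m → IsLeftmostOfContent la mu r c′ m′ → c ≤ c′ →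
        cellFlag (vat a) (conjAt mu) 1 m - cellFlag (vat a) (conjAt mu) 1 m′ ≤ c′ - c
      leftmostFlag-lipschitz r {m = m} {m′} lm@(m∈ , refl , _) (m′∈ , refl , _) c≤c′ =
        cellFlag-lipschitz la r (vat a) (conjAt mu) 1 m m′
          (proj₁ (flagPotentials-mono m∈ m′∈ (leftmost-col-mono r lm m′∈ c≤c′)))

      rightmostFlag-lipschitz : ∀ r {c c′ M M′} →
        IsRightmostOfContent la mu r c M → IsRightmostOfContent la mu r c′ M′ → c ≤ c′ →
        cellFlag (vat b) (conjAt la) 0 M - cellFlag (vat b) (conjAt la) 0 M′ ≤ c′ - c
      rightmostFlag-lipschitz r {M = M} {M′} (M∈ , refl , _) rm′@(M′∈ , refl , _) c≤c′ =
        cellFlag-lipschitz la r (vat b) (conjAt la) 0 M M′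
          (proj₂ (flagPotentials-mono M∈ M′∈ (rightmost-col-mono r rm′ M∈ c≤c′)))

      consecutive⇒ColumnStep : ∀ r {p q} {mf Mf : ℤ → Cell} →
        (∀ {c} → p ≤ c → c ≤ q → ContentOccurs la mu r c) →
        (∀ c → ContentOccurs la mu r c → IsRightmostOfContent la mu r c (Mf c)) →
        (∀ c → ContentOccurs la mu r c → IsLeftmostOfContent la mu r c (mf c)) →
        ∀ {x y} → Within p q x × Within p q y × Abutting x y →
        ColumnStep (λ column → cellFlag (vat a) (conjAt mu) 1 (mf (proj₂ column)))
                   (λ column → cellFlag (vat b) (conjAt la) 0 (Mf (proj₁ column))) x y
      consecutive⇒ColumnStep r {p} {q} {mf} {Mf} occurs rightmost leftmost
        {β , τ} {β′ , τ′} ((p≤β , β≤τ , τ≤q) , (p≤β′ , β′≤τ′ , τ′≤q) , refl) =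
        ℤₚ.≤-trans (leftmostFlag-lipschitz r (leftmostAt p≤τ τ≤q) (leftmostAt p≤τ′ τ′≤q) τ≤τ′)
                   (ℤₚ.≤-reflexive (sym (trans (height≡ β′≤τ′) (cancel τ′ τ)))) ,
        ℤₚ.≤-trans (rightmostFlag-lipschitz r (rightmostAt p≤β β≤q) (rightmostAt p≤β′ β′≤q) β≤β′)
                   (ℤₚ.≤-reflexive (sym (height≡ β≤τ)))
        where
        leftmostAt : ∀ {c} → p ≤ c → c ≤ q → IsLeftmostOfContent la mu r c (mf c)
        leftmostAt p≤c c≤q = leftmost _ (occurs p≤c c≤q)
        rightmostAt : ∀ {c} → p ≤ c → c ≤ q → IsRightmostOfContent la mu r c (Mf c)
        rightmostAt p≤c c≤q = rightmost _ (occurs p≤c c≤q)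
        cancel : ∀ τ′ τ → (τ′ + + 1) - (τ + + 1) ≡ τ′ - τ
        cancel = solve-∀
        τ≤β′ : τ ≤ β′
        τ≤β′ = ℤₚ.i≤i+j τ (+ 1)
        τ≤τ′ : τ ≤ τ′
        τ≤τ′ = ℤₚ.≤-trans τ≤β′ β′≤τ′
        β≤β′ : β ≤ β′
        β≤β′ = ℤₚ.≤-trans β≤τ τ≤β′
        p≤τ : p ≤ τ
        p≤τ = ℤₚ.≤-trans p≤β β≤τ
        p≤τ′ : p ≤ τ′
        p≤τ′ = ℤₚ.≤-trans p≤β′ β′≤τ′
        β≤q : β ≤ q
        β≤q = ℤₚ.≤-trans β≤τ τ≤q
        β′≤q : β′ ≤ q
        β′≤q = ℤₚ.≤-trans β′≤τ′ τ′≤q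

mainTheorem5 : (la mu : List ℕ) (r : ℤ) →
  IsPartition la → IsPartition mu → mu ⊆ₚ la →
  EdgewiseConnected (InSkew la mu) →
  (n : ℕ) (a b : Vec ℤ n) → IsColumnFlags la mu n a b →
  (D : OuterRibbonDecomposition la mu) →
  (dir : ℤ → Dir) → IsCuttingDir la mu r D dir →
  (Mf mf : ℤ → Cell) →
  (∀ c → ContentOccurs la mu r c → IsRightmostOfContent la mu r c (Mf c)) →
  (∀ c → ContentOccurs la mu r c → IsLeftmostOfContent la mu r c (mf c)) →
  (i j : Fin (k D)) →
  content la r (hd D i) ≤ content la r (tl D j) →
  IsColumnFlags
    (ribbonOuter (ThetaCols dir (content la r (hd D i)) (content la r (tl D j))))
    (ribbonInner (ThetaCols dir (content la r (hd D i)) (content la r (tl D j))))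
    (length (ThetaCols dir (content la r (hd D i)) (content la r (tl D j))))
    (inducedA mu a mf (ThetaCols dir (content la r (hd D i)) (content la r (tl D j))))
    (inducedB la b Mf (ThetaCols dir (content la r (hd D i)) (content la r (tl D j))))
mainTheorem5 la mu r λ-partition μ-partition _ connected n a b flags D dir _ Mf mf rightmost leftmost i j p≤q =
  ribbon-columnFlags _ _ (ThetaCols dir p q)
    (Linked.map (consecutive⇒ColumnStep λ-partition μ-partition connected {n} {a} {b} flags r occurs rightmost leftmost)
                (ThetaCols-consecutive dir p≤q))
  where
  p q : ℤ
  p = content la r (hd D i)
  q = content la r (tl D j)
  occurs : ∀ {c} → p ≤ c → c ≤ q → ContentOccurs la mu r c
  occurs = contentOccurs-between λ-partition μ-partition connected r
             (sub D i (hd D i) (proj₁ (hd-bl D i))) (sub D j (tl D j) (proj₁ (tl-tr D j)))
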